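{- Let $G=(V,E)$ be a simple graph with $n$ vertices such that: (a) $G$ coincides with its $(3+2)$-core; (b) $G$ has a rigid component $G'=(V',E')$ on $n'\ge 4$ vertices; (c) the set $V''=V\setminus V'$, of size $n''$, is incident to at least $2n''$ edges of $G$. Then at least one of the following holds: $G$ is Laman-spanning; or $G$ has a rigid component other than $G'$ on at least four vertices.
   Context: A graph with $n$ vertices and $m$ edges is Laman-sparse if every subgraph spanning $n'\ge2$ vertices and $m'$ edges satisfies $m'\le 2n'-3$; it is a Laman graph if in addition $m=2n-3$; it is Laman-spanning if it contains a spanning Laman subgraph. A rigid block of $G$ is a vertex set whose induced subgraph is Laman-spanning; a rigid component is an inclusion-wise maximal rigid block. The $3$-core of a graph is its maximal induced subgraph of minimum degree at least $3$; the $(3+2)$-core is the maximal induced subgraph obtained by starting from the $3$-core and repeatedly adding any vertex having at least two neighbours in the subgraph built so far. An edge is incident to a vertex set if at least one of its endpoints lies in that set. -}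

module Defs where

open import Data.Nat using (ℕ; zero; suc; _+_; _*_; _∸_; _≤_; _<ᵇ_)
open import Data.Bool using (Bool; true; false; _∧_; _∨_; if_then_else_)
open import Data.Fin using (Fin; toℕ)
open import Data.List using (List; map; allFin; cartesianProduct)
open import Data.Nat.ListAction using (sum)
open import Data.Product using (Σ; _×_; _,_)
open import Relation.Binary.PropositionalEquality using (_≡_; _≢_)

record Graph (n : ℕ) : Set where
  field
    adj    : Fin n → Fin n → Bool
    sym    : ∀ i j → adj i j ≡ adj j i
    irrefl : ∀ i → adj i i ≡ false
open Graph public

VSet : ℕ → Set
VSet n = Fin n → Bool

full : ∀ {n} → VSet n
full _ = true

compl : ∀ {n} → VSet n → VSet n
compl S v = if S v then false else true

_⊆_ : ∀ {n} → VSet n → VSet n → Set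
S ⊆ T = ∀ v → S v ≡ true → T v ≡ true

SameSet : ∀ {n} → VSet n → VSet n → Set
SameSet S T = ∀ v → S v ≡ T v

b2n : Bool → ℕ
b2n true  = 1
b2n false = 0

size : ∀ {n} → VSet n → ℕ
size {n} S = sum (map (λ v → b2n (S v)) (allFin n))

-- unordered pairs {i,j}, encoded as (i,j) with i < j
countPairs : ∀ {n} → (Fin n → Fin n → Bool) → ℕ
countPairs {n} P =
  sum (map (λ p → b2n ((toℕ (Data.Product.proj₁ p) <ᵇ toℕ (Data.Product.proj₂ p))
                       ∧ P (Data.Product.proj₁ p) (Data.Product.proj₂ p)))
           (cartesianProduct (allFin n) (allFin n)))

edgesIn : ∀ {n} → (Fin n → Fin n → Bool) → VSet n → ℕ
edgesIn A S = countPairs (λ i j → S i ∧ S j ∧ A i j)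

incidentEdges : ∀ {n} → Graph n → VSet n → ℕ
incidentEdges G S = countPairs (λ i j → (S i ∨ S j) ∧ adj G i j)

degIn : ∀ {n} → Graph n → VSet n → Fin n → ℕ
degIn {n} G S v = sum (map (λ u → b2n (S u ∧ adj G v u)) (allFin n))

-- A subgraph H of G[W] spanning W: symmetric edge relation, edges of G,
-- all endpoints in W (vertex set of the subgraph is all of W).
record SpanningSub {n} (G : Graph n) (W : VSet n) : Set where
  field
    edge    : Fin n → Fin n → Bool
    esym    : ∀ i j → edge i j ≡ edge j i
    inG     : ∀ i j → edge i j ≡ true → adj G i j ≡ true
    inW     : ∀ i j → edge i j ≡ true → W i ≡ true
open SpanningSub public

LamanSparse : ∀ {n} → (Fin n → Fin n → Bool) → VSet n → Set
LamanSparse A W = ∀ S → S ⊆ W → 2 ≤ size S → edgesIn A S + 3 ≤ 2 * size S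

-- Laman graph with vertex set W (m = 2n - 3; truncated subtraction makes
-- a single vertex (m = 0) a Laman graph).
IsLaman : ∀ {n} → (Fin n → Fin n → Bool) → VSet n → Set
IsLaman A W = LamanSparse A W × edgesIn A W ≡ 2 * size W ∸ 3

RigidBlock : ∀ {n} → Graph n → VSet n → Set
RigidBlock G W = Σ (SpanningSub G W) λ H → IsLaman (edge H) W

LamanSpanning : ∀ {n} → Graph n → Set
LamanSpanning G = RigidBlock G full

RigidComponent : ∀ {n} → Graph n → VSet n → Set
RigidComponent G W = RigidBlock G W × (∀ W' → W ⊆ W' → RigidBlock G W' → W' ⊆ W)

MinDeg3 : ∀ {n} → Graph n → VSet n → Set
MinDeg3 G S = ∀ v → S v ≡ true → 3 ≤ degIn G S v

Is3Core : ∀ {n} → Graph n → VSet n → Set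
Is3Core G C = MinDeg3 G C × (∀ T → C ⊆ T → MinDeg3 G T → T ⊆ C)

-- vertices of the (3+2)-core built from C: start with C and repeatedly add
-- a vertex with at least two (distinct) neighbours already added.
data In32 {n} (G : Graph n) (C : VSet n) : Fin n → Set where
  base : ∀ v → C v ≡ true → In32 G C v
  step : ∀ v u w → u ≢ w → In32 G C u → In32 G C w →
         adj G v u ≡ true → adj G v w ≡ true → In32 G C v

module Submission where

-- Let H₀ be a spanning Laman subgraph of the rigid component
-- V'.  Scan the edges of G incident to V'' = V ∖ V' one by one, adding an
-- edge to the current graph H whenever H stays Laman-sparse (H starts as
-- H₀, which is sparse on all of V).
--   * If some edge ab cannot be added, a set S with a, b ∈ S spans more
--     than 2|S| - 3 edges of H + ab.  Hence S is tight in H, so S is a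
--     rigid block; S spans at least 2|S| - 2 edges of a simple graph, which
--     forces |S| ≥ 4; and a or b lies in V''.  The rigid component
--     containing S is a second rigid component on at least four vertices.
--   * If every edge is added, H is Laman-sparse on V and has at least
--     (2n' - 3) + 2n'' = 2n - 3 edges, so H is a spanning Laman subgraph.

open import Defs
open import Data.Nat using (ℕ; _≤_; _*_)
open import Data.Fin using (Fin)
open import Data.Product using (Σ; _×_)
open import Data.Sum using (_⊎_)
open import Relation.Nullary using (¬_)

open import Data.Nat using (zero; suc; _+_; _∸_; _<_; _<ᵇ_; z≤n; s≤s; _≤?_; _<?_; _≟_)
open import Data.Nat.Properties
open import Data.Nat.Solver using (module +-*-Solver)
open +-*-Solver using (solve; _:=_; con; _:+_; _:*_)
open import Data.Fin using (zero; suc; toℕ) renaming (_≟_ to _≟F_)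
open import Data.Fin.Properties using (all?)
open import Data.Bool using (Bool; true; false; _∧_; _∨_) renaming (_≟_ to _≟B_)
open import Data.Bool.Properties using (∧-conicalˡ; ∧-conicalʳ; ∧-comm; ∨-comm; ¬-not)
open import Data.List using (List; []; _∷_; map; allFin; tabulate; cartesianProduct)
open import Data.List.Properties using (map-tabulate; map-++; map-cong; map-∘)
open import Data.List.Membership.Propositional using (_∈_)
open import Data.List.Membership.Propositional.Properties using (∈-cartesianProduct⁺; ∈-allFin)
open import Data.List.Relation.Unary.Any using (here; there)
open import Data.Nat.ListAction using (sum)
open import Data.Nat.ListAction.Properties using (sum-++)
open import Data.Product using (_,_; proj₁; proj₂)
open import Data.Sum using (inj₁; inj₂)
open import Data.Empty using (⊥; ⊥-elim)
open import Relation.Nullary using (Dec; yes; no; does; _×-dec_; ¬?; _→-dec_)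
open import Relation.Nullary.Decidable using (decidable-stable)
open import Relation.Binary.PropositionalEquality
  using (_≡_; refl; trans; cong; cong₂; subst; subst₂; module ≡-Reasoning)
  renaming (sym to ≡-sym)
open import Function using (_∘_; id)
open import Algebra.Properties.CommutativeSemigroup +-commutativeSemigroup using (interchange)

false≢true : false ≡ true → ⊥
false≢true ()

∧-intro : ∀ {x y} → x ≡ true → y ≡ true → (x ∧ y) ≡ true
∧-intro refl refl = refl

b2n-mono : ∀ {x y} → (x ≡ true → y ≡ true) → b2n x ≤ b2n y
b2n-mono {false} _ = z≤n
b2n-mono {true} f rewrite f refl = s≤s z≤n

∧₃-elim : ∀ x y z → (x ∧ y ∧ z) ≡ true → x ≡ true × y ≡ true × z ≡ true
∧₃-elim true true true _ = refl , refl , refl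

∧₃-intro : ∀ {x y z} → x ≡ true × y ≡ true × z ≡ true → (x ∧ y ∧ z) ≡ true
∧₃-intro (refl , refl , refl) = refl

∨-elim : ∀ {x y} → (x ∨ y) ≡ true → x ≡ true ⊎ y ≡ true
∨-elim {true} _ = inj₁ refl
∨-elim {false} p = inj₂ p

sumT : ∀ {n} → (Fin n → ℕ) → ℕ
sumT f = sum (tabulate f)

sumT-cong : ∀ {n} {f g : Fin n → ℕ} → (∀ i → f i ≡ g i) → sumT f ≡ sumT g
sumT-cong {zero} _ = refl
sumT-cong {suc n} e = cong₂ _+_ (e zero) (sumT-cong (e ∘ suc))

sumT-mono : ∀ {n} {f g : Fin n → ℕ} → (∀ i → f i ≤ g i) → sumT f ≤ sumT g
sumT-mono {zero} _ = z≤n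
sumT-mono {suc n} le = +-mono-≤ (le zero) (sumT-mono (le ∘ suc))

sumT-strict : ∀ {n} {f g : Fin n → ℕ} → (∀ i → f i ≤ g i) → ∀ v → f v < g v → sumT f < sumT g
sumT-strict {suc n} le zero lt = +-mono-<-≤ lt (sumT-mono (le ∘ suc))
sumT-strict {suc n} le (suc v) lt = +-mono-≤-< (le zero) (sumT-strict (le ∘ suc) v lt)

sumT-+ : ∀ {n} (f g : Fin n → ℕ) → sumT (λ i → f i + g i) ≡ sumT f + sumT g
sumT-+ {zero} _ _ = refl
sumT-+ {suc n} f g = trans (cong (f zero + g zero +_) (sumT-+ (f ∘ suc) (g ∘ suc)))
                           (interchange (f zero) (g zero) (sumT (f ∘ suc)) (sumT (g ∘ suc)))

sumT-zero : ∀ {n} (f : Fin n → ℕ) → (∀ i → f i ≡ 0) → sumT f ≡ 0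
sumT-zero {zero} _ _ = refl
sumT-zero {suc n} f z rewrite z zero = sumT-zero (f ∘ suc) (z ∘ suc)

eqb : ∀ {n} → Fin n → Fin n → Bool
eqb i a = does (i ≟F a)

sumT-eqb : ∀ {n} (a : Fin n) → sumT (λ i → b2n (eqb i a)) ≡ 1
sumT-eqb {suc n} zero = cong suc (sumT-zero {n} _ (λ _ → refl))
sumT-eqb {suc n} (suc a) = sumT-eqb a

-- Sizes of vertex sets

size≡ : ∀ {n} (S : VSet n) → size S ≡ sumT (λ i → b2n (S i))
size≡ {n} S = cong sum (map-tabulate id (λ i → b2n (S i)))

size-cong : ∀ {n} {S T : VSet n} → SameSet S T → size S ≡ size T
size-cong {S = S} {T} e =
  subst₂ _≡_ (≡-sym (size≡ S)) (≡-sym (size≡ T)) (sumT-cong (λ i → cong b2n (e i)))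

size-mono : ∀ {n} {S T : VSet n} → S ⊆ T → size S ≤ size T
size-mono {S = S} {T} sub =
  subst₂ _≤_ (≡-sym (size≡ S)) (≡-sym (size≡ T)) (sumT-mono (λ i → b2n-mono (sub i)))

⊆-size⇒⊇ : ∀ {n} {S T : VSet n} → S ⊆ T → size T ≤ size S → T ⊆ S
⊆-size⇒⊇ {S = S} {T} sub le v Tv with S v in Sv
... | true = refl
... | false = ⊥-elim (<⇒≱ S<T le)
  where
  S<T : size S < size T
  S<T = subst₂ _<_ (≡-sym (size≡ S)) (≡-sym (size≡ T))
          (sumT-strict (λ i → b2n-mono (sub i)) v
            (subst₂ _<_ (cong b2n (≡-sym Sv)) (cong b2n (≡-sym Tv)) (s≤s z≤n)))

size≤full : ∀ {n} (S : VSet n) → size S ≤ size {n} full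
size≤full {n} S = size-mono {n} {S} {full} (λ _ _ → refl)

size-split : ∀ {n} (W : VSet n) → size {n} full ≡ size W + size (compl W)
size-split {n} W = begin
  size {n} full                                      ≡⟨ size≡ {n} full ⟩
  sumT {n} (λ _ → 1)                                 ≡⟨ sumT-cong {n} inExactlyOne ⟩
  sumT (λ i → b2n (W i) + b2n (compl W i))           ≡⟨ sumT-+ (λ i → b2n (W i)) (λ i → b2n (compl W i)) ⟩
  sumT (λ i → b2n (W i)) + sumT (λ i → b2n (compl W i))
                                                     ≡⟨ ≡-sym (cong₂ _+_ (size≡ W) (size≡ (compl W))) ⟩
  size W + size (compl W)                            ∎
  where
  open ≡-Reasoning
  inExactlyOne : ∀ i → 1 ≡ b2n (W i) + b2n (compl W i)
  inExactlyOne i with W i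
  ... | true = refl
  ... | false = refl

-- Counting vertex pairs

ordered : ∀ {n} → Fin n → Fin n → Bool
ordered i j = toℕ i <ᵇ toℕ j

pairTerm : ∀ {n} → (Fin n → Fin n → Bool) → Fin n → Fin n → ℕ
pairTerm P i j = b2n (ordered i j ∧ P i j)

pairSum : ∀ {n} → (Fin n → Fin n → Bool) → ℕ
pairSum P = sumT (λ i → sumT (λ j → pairTerm P i j))

sum-cartesianProduct : ∀ {A B : Set} (g : A × B → ℕ) xs ys →
  sum (map g (cartesianProduct xs ys)) ≡ sum (map (λ x → sum (map (λ y → g (x , y)) ys)) xs)
sum-cartesianProduct g [] ys = refl
sum-cartesianProduct g (x ∷ xs) ys =
  trans (cong sum (map-++ g (map (x ,_) ys) (cartesianProduct xs ys)))
    (trans (sum-++ (map g (map (x ,_) ys)) _)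
      (cong₂ _+_ (cong sum (≡-sym (map-∘ ys))) (sum-cartesianProduct g xs ys)))

countPairs≡ : ∀ {n} (P : Fin n → Fin n → Bool) → countPairs P ≡ pairSum P
countPairs≡ {n} P =
  trans (sum-cartesianProduct _ (allFin n) (allFin n))
    (trans (cong sum (map-cong (λ i → cong sum (map-tabulate id (pairTerm P i))) (allFin n)))
           (cong sum (map-tabulate id (λ i → sumT (pairTerm P i)))))

countPairs-pointwise : ∀ {n} {P Q : Fin n → Fin n → Bool} →
  (∀ i j → pairTerm P i j ≤ pairTerm Q i j) → countPairs P ≤ countPairs Q
countPairs-pointwise {P = P} {Q} le =
  subst₂ _≤_ (≡-sym (countPairs≡ P)) (≡-sym (countPairs≡ Q))
    (sumT-mono (λ i → sumT-mono (le i)))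

pairSum-+ : ∀ {n} (P Q : Fin n → Fin n → Bool) →
  sumT (λ i → sumT (λ j → pairTerm P i j + pairTerm Q i j)) ≡ countPairs P + countPairs Q
pairSum-+ P Q = begin
  sumT (λ i → sumT (λ j → pairTerm P i j + pairTerm Q i j))
    ≡⟨ sumT-cong (λ i → sumT-+ (pairTerm P i) (pairTerm Q i)) ⟩
  sumT (λ i → sumT (pairTerm P i) + sumT (pairTerm Q i))
    ≡⟨ sumT-+ (λ i → sumT (pairTerm P i)) (λ i → sumT (pairTerm Q i)) ⟩
  pairSum P + pairSum Q
    ≡⟨ ≡-sym (cong₂ _+_ (countPairs≡ P) (countPairs≡ Q)) ⟩
  countPairs P + countPairs Q ∎
  where open ≡-Reasoning

countPairs-cong : ∀ {n} {P Q : Fin n → Fin n → Bool} → (∀ i j → P i j ≡ Q i j) →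
  countPairs P ≡ countPairs Q
countPairs-cong e = ≤-antisym
  (countPairs-pointwise (λ i j → ≤-reflexive (cong (λ b → b2n (ordered i j ∧ b)) (e i j))))
  (countPairs-pointwise (λ i j → ≤-reflexive (cong (λ b → b2n (ordered i j ∧ b)) (≡-sym (e i j)))))

countPairs-mono : ∀ {n} {P Q : Fin n → Fin n → Bool} →
  (∀ i j → ordered i j ≡ true → P i j ≡ true → Q i j ≡ true) → countPairs P ≤ countPairs Q
countPairs-mono {P = P} imp = countPairs-pointwise λ i j → b2n-mono λ p →
  let o = ∧-conicalˡ (ordered i j) (P i j) p
  in ∧-intro o (imp i j o (∧-conicalʳ (ordered i j) (P i j) p))

countPairs-∨ : ∀ {n} (P Q : Fin n → Fin n → Bool) →
  countPairs (λ i j → P i j ∨ Q i j) ≤ countPairs P + countPairs Q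
countPairs-∨ P Q = begin
  countPairs P∨Q ≡⟨ countPairs≡ P∨Q ⟩
  pairSum P∨Q    ≤⟨ sumT-mono (λ i → sumT-mono (λ j → split (ordered i j) (P i j) (Q i j))) ⟩
  sumT (λ i → sumT (λ j → pairTerm P i j + pairTerm Q i j)) ≡⟨ pairSum-+ P Q ⟩
  countPairs P + countPairs Q ∎
  where
  open ≤-Reasoning
  P∨Q = λ i j → P i j ∨ Q i j
  split : ∀ l p q → b2n (l ∧ (p ∨ q)) ≤ b2n (l ∧ p) + b2n (l ∧ q)
  split false _ _ = z≤n
  split true true _ = s≤s z≤n
  split true false q = ≤-refl

countPairs-disjoint : ∀ {n} (P Q : Fin n → Fin n → Bool) → (∀ i j → P i j ≡ true → Q i j ≡ false) →
  countPairs P + countPairs Q ≤ countPairs (λ i j → P i j ∨ Q i j)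
countPairs-disjoint P Q disj = begin
  countPairs P + countPairs Q ≡⟨ ≡-sym (pairSum-+ P Q) ⟩
  sumT (λ i → sumT (λ j → pairTerm P i j + pairTerm Q i j))
    ≤⟨ sumT-mono (λ i → sumT-mono (λ j → join (ordered i j) (P i j) (Q i j) (disj i j))) ⟩
  pairSum P∨Q    ≡⟨ ≡-sym (countPairs≡ P∨Q) ⟩
  countPairs P∨Q ∎
  where
  open ≤-Reasoning
  P∨Q = λ i j → P i j ∨ Q i j
  join : ∀ l p q → (p ≡ true → q ≡ false) → b2n (l ∧ p) + b2n (l ∧ q) ≤ b2n (l ∧ (p ∨ q))
  join false _ _ _ = z≤n
  join true true q d rewrite d refl = ≤-refl
  join true false q _ = ≤-refl

countPairs≤unordered : ∀ {n} (P : Fin n → Fin n → Bool) →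
  countPairs P ≤ sumT (λ i → sumT (λ j → b2n (P i j)))
countPairs≤unordered P = subst (_≤ sumT (λ i → sumT (λ j → b2n (P i j)))) (≡-sym (countPairs≡ P))
  (sumT-mono (λ i → sumT-mono (λ j → b2n-mono (∧-conicalʳ (ordered i j) (P i j)))))

countPairs-none : ∀ {n} (P : Fin n → Fin n → Bool) →
  (∀ i j → ordered i j ≡ true → P i j ≡ false) → countPairs P ≡ 0
countPairs-none P none = trans (countPairs≡ P)
  (sumT-zero (λ i → sumT (pairTerm P i)) (λ i → sumT-zero (pairTerm P i) (λ j → vanish (ordered i j) (P i j) (none i j))))
  where
  vanish : ∀ l p → (l ≡ true → p ≡ false) → b2n (l ∧ p) ≡ 0
  vanish false _ _ = refl
  vanish true p f rewrite f refl = refl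

edgesIn-mono : ∀ {n} {A B : Fin n → Fin n → Bool} {S T : VSet n} →
  (∀ i j → S i ≡ true → S j ≡ true → A i j ≡ true → T i ≡ true × T j ≡ true × B i j ≡ true) →
  edgesIn A S ≤ edgesIn B T
edgesIn-mono {A = A} {S = S} inside = countPairs-mono λ i j _ p →
  let (Si , Sj , Aij) = ∧₃-elim (S i) (S j) (A i j) p in ∧₃-intro (inside i j Si Sj Aij)

-- Edge counts of simple graphs on few vertices

pairSum-inside : ∀ {n} (S : VSet n) →
  2 * pairSum (λ i j → S i ∧ S j) + sumT (λ i → b2n (S i)) ≡
  sumT (λ i → b2n (S i)) * sumT (λ i → b2n (S i))
pairSum-inside {zero} S = refl
pairSum-inside {suc n} S with S zero | pairSum-inside (S ∘ suc)
... | true | ih = begin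
  2 * (m + c) + (1 + m)       ≡⟨ regroup m c ⟩
  (2 * c + m) + (2 * m + 1)   ≡⟨ cong (_+ (2 * m + 1)) ih ⟩
  m * m + (2 * m + 1)         ≡⟨ square m ⟩
  (1 + m) * (1 + m)           ∎
  where
  open ≡-Reasoning
  m = sumT (λ i → b2n (S (suc i)))
  c = pairSum (λ i j → S (suc i) ∧ S (suc j))
  regroup : ∀ m c → 2 * (m + c) + (1 + m) ≡ (2 * c + m) + (2 * m + 1)
  regroup = solve 2 (λ m c → con 2 :* (m :+ c) :+ (con 1 :+ m) :=
                             (con 2 :* c :+ m) :+ (con 2 :* m :+ con 1)) refl
  square : ∀ m → m * m + (2 * m + 1) ≡ (1 + m) * (1 + m)
  square = solve 1 (λ m → m :* m :+ (con 2 :* m :+ con 1) := (con 1 :+ m) :* (con 1 :+ m)) refl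
... | false | ih =
  trans (cong (λ x → 2 * (x + pairSum (λ i j → S (suc i) ∧ S (suc j))) + sumT (λ i → b2n (S (suc i))))
              (sumT-zero {n} _ (λ _ → refl)))
        ih

pairCount : ∀ {n} (S : VSet n) →
  2 * countPairs (λ i j → S i ∧ S j) + size S ≡ size S * size S
pairCount S = subst₂ (λ c s → 2 * c + s ≡ s * s)
  (≡-sym (countPairs≡ (λ i j → S i ∧ S j))) (≡-sym (size≡ S)) (pairSum-inside S)

four≤ : ∀ s c e → e ≤ c → 2 * c + s ≡ s * s → 2 ≤ s → 2 * s ≤ e + 2 → 4 ≤ s
four≤ s c e e≤c pairs 2≤s 2s≤e+2 = excludeSmall s 2≤s key
  where
  open ≤-Reasoning
  key : 5 * s ≤ s * s + 4
  key = begin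
    5 * s               ≡⟨ solve 1 (λ s → con 5 :* s := con 2 :* (con 2 :* s) :+ s) refl s ⟩
    2 * (2 * s) + s     ≤⟨ +-monoˡ-≤ s (*-monoʳ-≤ 2 (≤-trans 2s≤e+2 (+-monoˡ-≤ 2 e≤c))) ⟩
    2 * (c + 2) + s     ≡⟨ solve 2 (λ s c → con 2 :* (c :+ con 2) :+ s := (con 2 :* c :+ s) :+ con 4) refl s c ⟩
    (2 * c + s) + 4     ≡⟨ cong (_+ 4) pairs ⟩
    s * s + 4           ∎
  excludeSmall : ∀ s → 2 ≤ s → 5 * s ≤ s * s + 4 → 4 ≤ s
  excludeSmall 1 (s≤s ()) _
  excludeSmall 2 _ k = ⊥-elim (≤⇒≯ k (m≤m+n 9 1))
  excludeSmall 3 _ k = ⊥-elim (≤⇒≯ k (m≤m+n 14 1))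
  excludeSmall (suc (suc (suc (suc s)))) _ _ = s≤s (s≤s (s≤s (s≤s z≤n)))

edges≤pairs : ∀ {n} (A : Fin n → Fin n → Bool) (S : VSet n) →
  edgesIn A S ≤ countPairs (λ i j → S i ∧ S j)
edges≤pairs A S = countPairs-mono {P = λ i j → S i ∧ S j ∧ A i j} {Q = λ i j → S i ∧ S j} λ i j _ p →
  let (Si , Sj , _) = ∧₃-elim (S i) (S j) (A i j) p in ∧-intro Si Sj

edges-small : ∀ {n} (A : Fin n → Fin n → Bool) (S : VSet n) → size S ≤ 1 → edgesIn A S ≡ 0
edges-small A S s≤1 = n≤0⇒n≡0 (≤-trans (edges≤pairs A S) c≤0)
  where
  c = countPairs (λ i j → S i ∧ S j)
  s = size S
  s*s≤s : s * s ≤ s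
  s*s≤s = subst (s * s ≤_) (*-identityʳ s) (*-monoʳ-≤ s s≤1)
  c≤0 : c ≤ 0
  c≤0 = ≤-trans (m≤m+n c (c + 0)) (+-cancelʳ-≤ s (2 * c) 0 (subst (_≤ s) (≡-sym (pairCount S)) s*s≤s))

-- simple graphs on two or three vertices are Laman-sparse even after
-- adding one edge: an S spanning at least 2|S| - 2 edges has |S| ≥ 4
overfull⇒four : ∀ {n} (A : Fin n → Fin n → Bool) (S : VSet n) →
  2 ≤ size S → 2 * size S ≤ edgesIn A S + 2 → 4 ≤ size S
overfull⇒four A S = four≤ (size S) _ (edgesIn A S) (edges≤pairs A S) (pairCount S)

-- Exhaustive search over finite function spaces

Searchable : (B : Set) → (B → B → Set) → Set₁
Searchable B _≈_ = (P : B → Set) → (∀ {x y} → x ≈ y → P x → P y) →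
  ((x : B) → Dec (P x)) → Dec (Σ B P)

searchBool : Searchable Bool _≡_
searchBool P _ P? with P? true | P? false
... | yes p | _ = yes (true , p)
... | no _ | yes p = yes (false , p)
... | no ¬t | no ¬f = no λ { (true , p) → ¬t p ; (false , p) → ¬f p }

Pointwise : ∀ {n} {B : Set} → (B → B → Set) → (Fin n → B) → (Fin n → B) → Set
Pointwise _≈_ f g = ∀ i → f i ≈ g i

cons : ∀ {n} {B : Set} → B → (Fin n → B) → Fin (suc n) → B
cons b g zero = b
cons b g (suc i) = g i

searchFun : ∀ {B : Set} {_≈_ : B → B → Set} → (∀ x → x ≈ x) → Searchable B _≈_ →
  ∀ n → Searchable (Fin n → B) (Pointwise {n} _≈_)
searchFun rfl searchB zero P inv P? with P? (λ ())
... | yes p = yes (_ , p)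
... | no ¬p = no λ { (f , pf) → ¬p (inv (λ ()) pf) }
searchFun {B} {_≈_} rfl searchB (suc n) P inv P? with searchB HeadOK headInv head?
  where
  HeadOK : B → Set
  HeadOK b = Σ (Fin n → B) (λ g → P (cons b g))
  headInv : ∀ {x y} → x ≈ y → HeadOK x → HeadOK y
  headInv {x} {y} x≈y (g , p) = g , inv cons≈ p
    where
    cons≈ : Pointwise _≈_ (cons x g) (cons y g)
    cons≈ zero = x≈y
    cons≈ (suc i) = rfl (g i)
  head? : (b : B) → Dec (HeadOK b)
  head? b = searchFun rfl searchB n (λ g → P (cons b g)) (λ g≈g' → inv (cons≈ g≈g')) (λ g → P? (cons b g))
    where
    cons≈ : ∀ {g g'} → Pointwise _≈_ g g' → Pointwise _≈_ (cons b g) (cons b g')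
    cons≈ _ zero = rfl b
    cons≈ g≈g' (suc i) = g≈g' i
... | yes (b , g , p) = yes (cons b g , p)
... | no ¬head = no λ { (f , pf) → ¬head (f zero , f ∘ suc , inv (eta f) pf) }
  where
  eta : ∀ f → Pointwise _≈_ f (cons (f zero) (f ∘ suc))
  eta f zero = rfl (f zero)
  eta f (suc i) = rfl (f (suc i))

searchVSet : ∀ n → Searchable (VSet n) SameSet
searchVSet n = searchFun (λ _ → refl) searchBool n

searchRel : ∀ n → Searchable (Fin n → Fin n → Bool) (Pointwise SameSet)
searchRel n = searchFun {_≈_ = SameSet} (λ _ _ → refl) (searchVSet n) n

-- Sparsity and rigidity are decidable

edgesIn-cong : ∀ {n} {A A' : Fin n → Fin n → Bool} {S S' : VSet n} →
  Pointwise SameSet A A' → SameSet S S' → edgesIn A S ≡ edgesIn A' S'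
edgesIn-cong eA eS = countPairs-cong λ i j → cong₂ _∧_ (eS i) (cong₂ _∧_ (eS j) (eA i j))

⊆-dec : ∀ {n} (S W : VSet n) → Dec (S ⊆ W)
⊆-dec S W = all? (λ v → (S v ≟B true) →-dec (W v ≟B true))

Violator : ∀ {n} → (Fin n → Fin n → Bool) → VSet n → VSet n → Set
Violator A W S = S ⊆ W × 2 ≤ size S × ¬ (edgesIn A S + 3 ≤ 2 * size S)

sparse-or-violator : ∀ {n} (A : Fin n → Fin n → Bool) (W : VSet n) →
  LamanSparse A W ⊎ Σ (VSet n) (Violator A W)
sparse-or-violator {n} A W
  with searchVSet n (Violator A W) inv
         (λ S → ⊆-dec S W ×-dec (2 ≤? size S) ×-dec ¬? (edgesIn A S + 3 ≤? 2 * size S))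
  where
  inv : ∀ {S S'} → SameSet S S' → Violator A W S → Violator A W S'
  inv {S} {S'} e (sub , 2≤S , tooMany) =
    (λ v S'v → sub v (trans (e v) S'v)) ,
    subst (2 ≤_) (size-cong e) 2≤S ,
    λ le → tooMany (subst₂ (λ m s → m + 3 ≤ 2 * s)
                       (edgesIn-cong (λ _ _ → refl) (λ v → ≡-sym (e v)))
                       (size-cong (λ v → ≡-sym (e v))) le)
... | yes violator = inj₂ violator
... | no none = inj₁ λ S sub 2≤S →
  decidable-stable (edgesIn A S + 3 ≤? 2 * size S) (λ tooMany → none (S , sub , 2≤S , tooMany))

sparse-dec : ∀ {n} (A : Fin n → Fin n → Bool) (W : VSet n) → Dec (LamanSparse A W)
sparse-dec A W with sparse-or-violator A W
... | inj₁ sparse = yes sparse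
... | inj₂ (S , sub , 2≤S , tooMany) = no λ sparse → tooMany (sparse S sub 2≤S)

-- the data of a RigidBlock G W, with the spanning subgraph unbundled into
-- its edge relation A so that A can be searched for
RigidWitness : ∀ {n} → Graph n → VSet n → (Fin n → Fin n → Bool) → Set
RigidWitness G W A = (∀ i j → A i j ≡ A j i) × (∀ i j → A i j ≡ true → adj G i j ≡ true) ×
                     (∀ i j → A i j ≡ true → W i ≡ true) × IsLaman A W

rigid-dec : ∀ {n} (G : Graph n) (W : VSet n) → Dec (RigidBlock G W)
rigid-dec {n} G W with searchRel n (RigidWitness G W) inv
     (λ A → all? (λ i → all? (λ j → A i j ≟B A j i)) ×-dec
            all? (λ i → all? (λ j → (A i j ≟B true) →-dec (adj G i j ≟B true))) ×-dec
            all? (λ i → all? (λ j → (A i j ≟B true) →-dec (W i ≟B true))) ×-dec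
            (sparse-dec A W ×-dec (edgesIn A W ≟ 2 * size W ∸ 3)))
  where
  inv : ∀ {A A'} → Pointwise SameSet A A' → RigidWitness G W A → RigidWitness G W A'
  inv e (sy , inG , inW , sparse , count) =
    (λ i j → trans (≡-sym (e i j)) (trans (sy i j) (e j i))) ,
    (λ i j p → inG i j (trans (e i j) p)) ,
    (λ i j p → inW i j (trans (e i j) p)) ,
    (λ S sub 2≤S → subst (λ m → m + 3 ≤ 2 * size S) (edgesIn-cong {S = S} {S' = S} e (λ _ → refl)) (sparse S sub 2≤S)) ,
    trans (≡-sym (edgesIn-cong {S = W} {S' = W} e (λ _ → refl))) count
... | yes (A , sy , inG , inW , laman) =
  yes (record { edge = A ; esym = sy ; inG = inG ; inW = inW } , laman)
... | no none = no λ { (H , laman) → none (edge H , esym H , inG H , inW H , laman) }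

rigid-cong : ∀ {n} (G : Graph n) {W W' : VSet n} → SameSet W W' → RigidBlock G W → RigidBlock G W'
rigid-cong G {W} {W'} e (H , sparse , count) =
  record { edge = edge H ; esym = esym H ; inG = inG H ; inW = λ i j p → trans (≡-sym (e i)) (inW H i j p) } ,
  (λ S sub 2≤S → sparse S (λ v p → trans (e v) (sub v p)) 2≤S) ,
  trans (edgesIn-cong (λ _ _ → refl) (λ v → ≡-sym (e v)))
        (trans count (cong (λ s → 2 * s ∸ 3) (size-cong e)))

-- Every rigid block lies in a rigid component

-- Replace W by a strictly larger rigid block as long as one exists; since
-- n ≤ |W| + k, this happens at most k times.
extendBlock : ∀ {n} (G : Graph n) (k : ℕ) (W : VSet n) → RigidBlock G W →
  size {n} full ≤ size W + k → Σ (VSet n) (λ W* → W ⊆ W* × RigidComponent G W*)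
extendBlock {n} G k W rigidW bound
  with searchVSet n Larger inv (λ W' → ⊆-dec W W' ×-dec rigid-dec G W' ×-dec (size W <? size W'))
  where
  Larger : VSet n → Set
  Larger W' = W ⊆ W' × RigidBlock G W' × size W < size W'
  inv : ∀ {X Y} → SameSet X Y → Larger X → Larger Y
  inv e (sub , rigid , lt) =
    (λ v p → trans (≡-sym (e v)) (sub v p)) , rigid-cong G e rigid , subst (size W <_) (size-cong e) lt
... | no noLarger =
  W , (λ _ p → p) , rigidW ,
  λ W' sub rigid' → ⊆-size⇒⊇ sub (≮⇒≥ (λ lt → noLarger (W' , sub , rigid' , lt)))
... | yes (W' , sub , rigid' , lt) with k
...   | zero = ⊥-elim (<⇒≱ lt (≤-trans (size≤full W') (subst (size {n} full ≤_) (+-identityʳ (size W)) bound)))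
...   | suc k with extendBlock G k W' rigid'
                     (≤-trans bound (subst (_≤ size W' + k) (≡-sym (+-suc (size W) k)) (+-monoˡ-≤ k lt)))
...     | (W* , sub' , component) = W* , (λ v p → sub' v (sub v p)) , component

componentContaining : ∀ {n} (G : Graph n) (W : VSet n) → RigidBlock G W →
  Σ (VSet n) (λ W* → W ⊆ W* × RigidComponent G W*)
componentContaining {n} G W rigidW = extendBlock G (size {n} full) W rigidW (m≤n+m (size {n} full) (size W))

-- Adding one edge

single : ∀ {n} → Fin n → Fin n → Fin n → Fin n → Bool
single a b i j = eqb i a ∧ eqb j b

single-true : ∀ {n} (a b i j : Fin n) → single a b i j ≡ true → i ≡ a × j ≡ b
single-true a b i j p with i ≟F a | j ≟F b
... | yes i≡a | yes j≡b = i≡a , j≡b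
... | yes _ | no _ = ⊥-elim (false≢true p)
... | no _ | _ = ⊥-elim (false≢true p)

addEdge : ∀ {n} → (Fin n → Fin n → Bool) → Fin n → Fin n → Fin n → Fin n → Bool
addEdge H a b i j = H i j ∨ (single a b i j ∨ single b a i j)

addEdge-cases : ∀ {n} (H : Fin n → Fin n → Bool) (a b i j : Fin n) → addEdge H a b i j ≡ true →
  H i j ≡ true ⊎ ((i ≡ a × j ≡ b) ⊎ (i ≡ b × j ≡ a))
addEdge-cases H a b i j p with H i j | single a b i j in ab | single b a i j in ba
... | true | _ | _ = inj₁ refl
... | false | true | _ = inj₂ (inj₁ (single-true a b i j ab))
... | false | false | true = inj₂ (inj₂ (single-true b a i j ba))
... | false | false | false = ⊥-elim (false≢true p)

addEdge-sym : ∀ {n} (H : Fin n → Fin n → Bool) (a b : Fin n) → (∀ i j → H i j ≡ H j i) →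
  ∀ i j → addEdge H a b i j ≡ addEdge H a b j i
addEdge-sym H a b symH i j = cong₂ _∨_ (symH i j)
  (trans (∨-comm (single a b i j) (single b a i j))
         (cong₂ _∨_ (∧-comm (eqb i b) (eqb j a)) (∧-comm (eqb i a) (eqb j b))))

addEdge-swap : ∀ {n} (H : Fin n → Fin n → Bool) (a b : Fin n) →
  Pointwise SameSet (addEdge H a b) (addEdge H b a)
addEdge-swap H a b i j = cong (H i j ∨_) (∨-comm (single a b i j) (single b a i j))

addEdge-⊇ : ∀ {n} (H : Fin n → Fin n → Bool) (a b i j : Fin n) → H i j ≡ true → addEdge H a b i j ≡ true
addEdge-⊇ H a b i j p rewrite p = refl

addEdge-new : ∀ {n} (H : Fin n → Fin n → Bool) (a b : Fin n) → addEdge H a b a b ≡ true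
addEdge-new H a b with a ≟F a | b ≟F b | H a b
... | yes _ | yes _ | false = refl
... | yes _ | yes _ | true = refl
... | no a≢a | _ | _ = ⊥-elim (a≢a refl)
... | yes _ | no b≢b | _ = ⊥-elim (b≢b refl)

countPairs-single : ∀ {n} (a b : Fin n) → countPairs (single a b) ≤ 1
countPairs-single {n} a b = ≤-trans (countPairs≤unordered (single a b))
  (≤-reflexive (trans (sumT-cong row) (sumT-eqb a)))
  where
  row : ∀ i → sumT (λ j → b2n (single a b i j)) ≡ b2n (eqb i a)
  row i with eqb i a
  ... | true = sumT-eqb b
  ... | false = sumT-zero {n} _ (λ _ → refl)

countPairs-single-reversed : ∀ {n} (a b : Fin n) → ordered a b ≡ true → countPairs (single b a) ≡ 0
countPairs-single-reversed a b a<b = countPairs-none (single b a) reversed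
  where
  <ᵇ-asym : ∀ m k → (m <ᵇ k) ≡ true → (k <ᵇ m) ≡ true → ⊥
  <ᵇ-asym zero (suc k) _ ()
  <ᵇ-asym (suc m) (suc k) p q = <ᵇ-asym m k p q
  reversed : ∀ i j → ordered i j ≡ true → single b a i j ≡ false
  reversed i j i<j with single b a i j in s
  ... | false = refl
  ... | true with single-true b a i j s
  ...   | refl , refl = ⊥-elim (<ᵇ-asym (toℕ a) (toℕ b) a<b i<j)

addEdge-count : ∀ {n} (H : Fin n → Fin n → Bool) (a b : Fin n) → ordered a b ≡ true →
  (S : VSet n) → edgesIn (addEdge H a b) S ≤ edgesIn H S + 1
addEdge-count H a b a<b S = begin
  edgesIn (addEdge H a b) S
    ≤⟨ countPairs-mono (λ i j _ → distribute (S i) (S j) (H i j) (single a b i j ∨ single b a i j)) ⟩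
  countPairs (λ i j → (S i ∧ S j ∧ H i j) ∨ (single a b i j ∨ single b a i j))
    ≤⟨ countPairs-∨ (λ i j → S i ∧ S j ∧ H i j) (λ i j → single a b i j ∨ single b a i j) ⟩
  edgesIn H S + countPairs (λ i j → single a b i j ∨ single b a i j)
    ≤⟨ +-monoʳ-≤ (edgesIn H S) (countPairs-∨ (single a b) (single b a)) ⟩
  edgesIn H S + (countPairs (single a b) + countPairs (single b a))
    ≤⟨ +-monoʳ-≤ (edgesIn H S) (+-mono-≤ (countPairs-single a b)
                                         (≤-reflexive (countPairs-single-reversed a b a<b))) ⟩
  edgesIn H S + 1 ∎
  where
  open ≤-Reasoning
  distribute : ∀ x y h u → (x ∧ y ∧ (h ∨ u)) ≡ true → ((x ∧ y ∧ h) ∨ u) ≡ true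
  distribute true true true _ _ = refl
  distribute true true false true _ = refl

addEdge-outside : ∀ {n} (H : Fin n → Fin n → Bool) (a b : Fin n) (S : VSet n) → S a ≡ false →
  edgesIn (addEdge H a b) S ≤ edgesIn H S
addEdge-outside H a b S Sa = edgesIn-mono old
  where
  old : ∀ i j → S i ≡ true → S j ≡ true → addEdge H a b i j ≡ true → S i ≡ true × S j ≡ true × H i j ≡ true
  old i j Si Sj e with addEdge-cases H a b i j e
  ... | inj₁ h = Si , Sj , h
  ... | inj₂ (inj₁ (refl , _)) = ⊥-elim (false≢true (trans (≡-sym Sa) Si))
  ... | inj₂ (inj₂ (_ , refl)) = ⊥-elim (false≢true (trans (≡-sym Sa) Sj))

endpoints-inside : ∀ {n} (H : Fin n → Fin n → Bool) (a b : Fin n) (S : VSet n) →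
  edgesIn H S < edgesIn (addEdge H a b) S → S a ≡ true × S b ≡ true
endpoints-inside H a b S grows = inside a (addEdge-outside H a b S) ,
  inside b (λ Sb → subst (_≤ edgesIn H S) (edgesIn-cong {S = S} {S' = S} (addEdge-swap H b a) (λ _ → refl))
                         (addEdge-outside H b a S Sb))
  where
  inside : ∀ v → (S v ≡ false → edgesIn (addEdge H a b) S ≤ edgesIn H S) → S v ≡ true
  inside v noGrowth with S v ≟B true
  ... | yes Sv = Sv
  ... | no Sv≢true = ⊥-elim (<⇒≱ grows (noGrowth (¬-not Sv≢true)))

-- Tight sets and sparsity beyond the support

tight⇒rigid : ∀ {n} (G : Graph n) (H : Fin n → Fin n → Bool) → (∀ i j → H i j ≡ H j i) →
  (∀ i j → H i j ≡ true → adj G i j ≡ true) → LamanSparse H full →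
  (S : VSet n) → edgesIn H S + 3 ≡ 2 * size S → RigidBlock G S
tight⇒rigid {n} G H symH H⊆G sparseH S tight =
  record { edge = H[S] ; esym = symmetric ; inG = inG' ; inW = λ i j p → proj₁ (∧₃-elim (S i) (S j) (H i j) p) } ,
  (λ T _ 2≤T → ≤-trans (+-monoˡ-≤ 3 (edgesIn-mono {S = T} {T = T} drop)) (sparseH T (λ _ _ → refl) 2≤T)) ,
  (begin
    edgesIn H[S] S         ≡⟨ ≤-antisym (edgesIn-mono {S = S} {T = S} drop) (edgesIn-mono keep) ⟩
    edgesIn H S            ≡⟨ ≡-sym (m+n∸n≡m (edgesIn H S) 3) ⟩
    edgesIn H S + 3 ∸ 3    ≡⟨ cong (_∸ 3) tight ⟩
    2 * size S ∸ 3         ∎)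
  where
  open ≡-Reasoning
  H[S] : Fin n → Fin n → Bool
  H[S] i j = S i ∧ S j ∧ H i j
  symmetric : ∀ i j → H[S] i j ≡ H[S] j i
  symmetric i j = trans (cong (λ h → S i ∧ S j ∧ h) (symH i j)) (∧-swap (S i) (S j) (H j i))
    where
    ∧-swap : ∀ x y z → (x ∧ y ∧ z) ≡ (y ∧ x ∧ z)
    ∧-swap false false _ = refl
    ∧-swap false true _ = refl
    ∧-swap true false _ = refl
    ∧-swap true true _ = refl
  inG' : ∀ i j → H[S] i j ≡ true → adj G i j ≡ true
  inG' i j p = H⊆G i j (proj₂ (proj₂ (∧₃-elim (S i) (S j) (H i j) p)))
  drop : ∀ {T : VSet n} i j → T i ≡ true → T j ≡ true → H[S] i j ≡ true →
    T i ≡ true × T j ≡ true × H i j ≡ true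
  drop i j Ti Tj p = Ti , Tj , proj₂ (proj₂ (∧₃-elim (S i) (S j) (H i j) p))
  keep : ∀ i j → S i ≡ true → S j ≡ true → H i j ≡ true → S i ≡ true × S j ≡ true × H[S] i j ≡ true
  keep i j Si Sj h = Si , Sj , ∧₃-intro (Si , Sj , h)

_∩_ : ∀ {n} → VSet n → VSet n → VSet n
(S ∩ W) v = S v ∧ W v

∩-⊆ˡ : ∀ {n} (S W : VSet n) → (S ∩ W) ⊆ S
∩-⊆ˡ S W v p = ∧-conicalˡ (S v) (W v) p

∩-⊆ʳ : ∀ {n} (S W : VSet n) → (S ∩ W) ⊆ W
∩-⊆ʳ S W v p = ∧-conicalʳ (S v) (W v) p

edgesIn-∩ : ∀ {n} (E : Fin n → Fin n → Bool) (W : VSet n) → (∀ i j → E i j ≡ E j i) →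
  (∀ i j → E i j ≡ true → W i ≡ true) → (S : VSet n) → edgesIn E S ≤ edgesIn E (S ∩ W)
edgesIn-∩ E W symE E⊆W S = edgesIn-mono {S = S} {T = S ∩ W} λ i j Si Sj e →
  ∧-intro Si (E⊆W i j e) , ∧-intro Sj (E⊆W j i (trans (symE j i) e)) , e

-- A graph that is Laman-sparse on W and has all its edges inside W is
-- Laman-sparse on the whole vertex set: only S ∩ W carries edges of S.
sparse-on-full : ∀ {n} (E : Fin n → Fin n → Bool) (W : VSet n) → (∀ i j → E i j ≡ E j i) →
  (∀ i j → E i j ≡ true → W i ≡ true) → LamanSparse E W → LamanSparse E full
sparse-on-full {n} E W symE E⊆W sparseE S _ 2≤S with 2 ≤? size (S ∩ W)
... | yes 2≤S∩W = begin
  edgesIn E S + 3          ≤⟨ +-monoˡ-≤ 3 (edgesIn-∩ E W symE E⊆W S) ⟩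
  edgesIn E (S ∩ W) + 3    ≤⟨ sparseE (S ∩ W) (∩-⊆ʳ S W) 2≤S∩W ⟩
  2 * size (S ∩ W)         ≤⟨ *-monoʳ-≤ 2 (size-mono (∩-⊆ˡ S W)) ⟩
  2 * size S               ∎
  where open ≤-Reasoning
... | no S∩W<2 = begin
  edgesIn E S + 3          ≤⟨ +-monoˡ-≤ 3 (edgesIn-∩ E W symE E⊆W S) ⟩
  edgesIn E (S ∩ W) + 3    ≡⟨ cong (_+ 3) (edges-small E (S ∩ W) (≤-pred (≰⇒> S∩W<2))) ⟩
  3                        ≤⟨ m≤m+n 3 1 ⟩
  2 * 2                    ≤⟨ *-monoʳ-≤ 2 2≤S ⟩
  2 * size S               ∎
  where open ≤-Reasoning

-- Greedy augmentation by the edges incident to V ∖ R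

module Greedy {n} (G : Graph n) (R : VSet n) (E₀ : Fin n → Fin n → Bool) where

  candidate : Fin n × Fin n → Bool
  candidate (a , b) = ordered a b ∧ ((compl R a ∨ compl R b) ∧ adj G a b)

  Inv : (Fin n → Fin n → Bool) → Set
  Inv H = (∀ i j → H i j ≡ H j i) × (∀ i j → H i j ≡ true → adj G i j ≡ true) ×
          LamanSparse H full × (∀ i j → E₀ i j ≡ true → H i j ≡ true)

  Obstruction : Set
  Obstruction = Σ (VSet n) λ S → RigidBlock G S × 4 ≤ size S × Σ (Fin n) λ v → S v ≡ true × R v ≡ false

  Augmented : List (Fin n × Fin n) → (Fin n → Fin n → Bool) → Set
  Augmented ps H = Σ (Fin n → Fin n → Bool) λ H' → Inv H' × (∀ i j → H i j ≡ true → H' i j ≡ true) ×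
                   (∀ p → p ∈ ps → candidate p ≡ true → H' (proj₁ p) (proj₂ p) ≡ true)

  leaves : ∀ a b → (compl R a ∨ compl R b) ≡ true → ∀ (S : VSet n) → S a ≡ true → S b ≡ true →
    Σ (Fin n) λ v → S v ≡ true × R v ≡ false
  leaves a b out S Sa Sb with R a in Ra | R b in Rb
  ... | false | _ = a , Sa , Ra
  ... | true | false = b , Sb , Rb
  ... | true | true = ⊥-elim (false≢true out)

  -- If the candidate ab cannot be added, the violated set S is tight in H
  -- (so a rigid block), has ≥ 4 vertices, and contains a and b.
  blocked : ∀ H → Inv H → ∀ a b → candidate (a , b) ≡ true →
    (S : VSet n) → Violator (addEdge H a b) full S → Obstruction
  blocked H (symH , H⊆G , sparseH , _) a b cand S (_ , 2≤S , tooMany) =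
    S , tight⇒rigid G H symH H⊆G sparseH S tight , overfull⇒four (addEdge H a b) S 2≤S 2S≤e'+2 ,
    leaves a b out S Sa Sb
    where
    a<b = proj₁ (∧₃-elim (ordered a b) (compl R a ∨ compl R b) (adj G a b) cand)
    out = proj₁ (proj₂ (∧₃-elim (ordered a b) (compl R a ∨ compl R b) (adj G a b) cand))
    e = edgesIn H S
    e' = edgesIn (addEdge H a b) S
    e+3≤2S : e + 3 ≤ 2 * size S
    e+3≤2S = sparseH S (λ _ _ → refl) 2≤S
    2S≤e'+2 : 2 * size S ≤ e' + 2
    2S≤e'+2 = ≤-pred (subst (suc (2 * size S) ≤_) (+-suc e' 2) (≰⇒> tooMany))
    tight : e + 3 ≡ 2 * size S
    tight = ≤-antisym e+3≤2S (begin
      2 * size S    ≤⟨ 2S≤e'+2 ⟩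
      e' + 2        ≤⟨ +-monoˡ-≤ 2 (addEdge-count H a b a<b S) ⟩
      e + 1 + 2     ≡⟨ +-assoc e 1 2 ⟩
      e + 3         ∎)
      where open ≤-Reasoning
    grows : e < e'
    grows = +-cancelʳ-< 3 e e' (≤-trans (s≤s e+3≤2S) (≰⇒> tooMany))
    Sa = proj₁ (endpoints-inside H a b S grows)
    Sb = proj₂ (endpoints-inside H a b S grows)

  accepted : ∀ H → Inv H → ∀ a b → candidate (a , b) ≡ true → LamanSparse (addEdge H a b) full →
    Inv (addEdge H a b)
  accepted H (symH , H⊆G , _ , E₀⊆H) a b cand sparse' =
    addEdge-sym H a b symH , inG' , sparse' , (λ i j p → addEdge-⊇ H a b i j (E₀⊆H i j p))
    where
    ab∈G = proj₂ (proj₂ (∧₃-elim (ordered a b) (compl R a ∨ compl R b) (adj G a b) cand))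
    inG' : ∀ i j → addEdge H a b i j ≡ true → adj G i j ≡ true
    inG' i j p with addEdge-cases H a b i j p
    ... | inj₁ h = H⊆G i j h
    ... | inj₂ (inj₁ (refl , refl)) = ab∈G
    ... | inj₂ (inj₂ (refl , refl)) = trans (Graph.sym G i j) ab∈G

  greedy : (ps : List (Fin n × Fin n)) (H : Fin n → Fin n → Bool) → Inv H → Augmented ps H ⊎ Obstruction
  greedy [] H inv = inj₁ (H , inv , (λ _ _ p → p) , λ _ ())
  greedy ((a , b) ∷ ps) H inv with candidate (a , b) in cand
  ... | false with greedy ps H inv
  ...   | inj₂ obstruction = inj₂ obstruction
  ...   | inj₁ (H' , inv' , H⊆H' , covers) = inj₁ (H' , inv' , H⊆H' , covers')
    where
    covers' : ∀ p → p ∈ ((a , b) ∷ ps) → candidate p ≡ true → H' (proj₁ p) (proj₂ p) ≡ true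
    covers' _ (here refl) c = ⊥-elim (false≢true (trans (≡-sym cand) c))
    covers' p (there p∈ps) c = covers p p∈ps c
  greedy ((a , b) ∷ ps) H inv | true with sparse-or-violator (addEdge H a b) full
  ... | inj₂ (S , violator) = inj₂ (blocked H inv a b cand S violator)
  ... | inj₁ sparse' with greedy ps (addEdge H a b) (accepted H inv a b cand sparse')
  ...   | inj₂ obstruction = inj₂ obstruction
  ...   | inj₁ (H' , inv' , H+ab⊆H' , covers) =
    inj₁ (H' , inv' , (λ i j p → H+ab⊆H' i j (addEdge-⊇ H a b i j p)) , covers')
    where
    covers' : ∀ p → p ∈ ((a , b) ∷ ps) → candidate p ≡ true → H' (proj₁ p) (proj₂ p) ≡ true
    covers' _ (here refl) _ = H+ab⊆H' a b (addEdge-new H a b)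
    covers' p (there p∈ps) c = covers p p∈ps c

-- The two outcomes of the augmentation

secondComponent : ∀ {n} (G : Graph n) (V' S : VSet n) → RigidBlock G S → 4 ≤ size S →
  (v : Fin n) → S v ≡ true → V' v ≡ false →
  Σ (VSet n) (λ W → RigidComponent G W × 4 ≤ size W × ¬ SameSet W V')
secondComponent G V' S rigidS 4≤S v Sv V'v with componentContaining G S rigidS
... | (W , S⊆W , componentW) =
  W , componentW , ≤-trans 4≤S (size-mono S⊆W) ,
  λ W≡V' → false≢true (trans (≡-sym V'v) (trans (≡-sym (W≡V' v)) (S⊆W v Sv)))

-- A Laman-sparse subgraph H of G containing a Laman graph A₀ on V' and all
-- edges incident to V'' = V ∖ V' has at least (2n' - 3) + 2n'' = 2n - 3
-- edges when (c) holds, so it is a spanning Laman subgraph of G.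
augmented⇒spanning : ∀ {n} (G : Graph n) (V' : VSet n) (A₀ H : Fin n → Fin n → Bool) →
  edgesIn A₀ V' ≡ 2 * size V' ∸ 3 → 2 ≤ size V' →
  2 * size (compl V') ≤ incidentEdges G (compl V') →
  (∀ i j → H i j ≡ H j i) → (∀ i j → H i j ≡ true → adj G i j ≡ true) → LamanSparse H full →
  (∀ i j → A₀ i j ≡ true → H i j ≡ true) →
  (∀ i j → ordered i j ≡ true → ((compl V' i ∨ compl V' j) ∧ adj G i j) ≡ true → H i j ≡ true) →
  LamanSpanning G
augmented⇒spanning {n} G V' A₀ H countA₀ 2≤n' incident symH H⊆G sparseH A₀⊆H incident⊆H =
  record { edge = H ; esym = symH ; inG = H⊆G ; inW = λ _ _ _ → refl } ,
  sparseH ,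
  trans (≡-sym (m+n∸n≡m e 3)) (cong (_∸ 3) (≤-antisym upper lower))
  where
  e = edgesIn H full
  n' = size V'
  n'' = size (compl V')
  Inside : Fin n → Fin n → Bool
  Inside i j = V' i ∧ V' j ∧ A₀ i j
  Incident : Fin n → Fin n → Bool
  Incident i j = (compl V' i ∨ compl V' j) ∧ adj G i j
  upper : e + 3 ≤ 2 * size {n} full
  upper = sparseH full (λ _ _ → refl) (≤-trans 2≤n' (size≤full V'))
  disjoint : ∀ i j → Inside i j ≡ true → Incident i j ≡ false
  disjoint i j p with ∧₃-elim (V' i) (V' j) (A₀ i j) p
  ... | V'i , V'j , _ rewrite V'i | V'j = refl
  covered : ∀ i j → ordered i j ≡ true → (Inside i j ∨ Incident i j) ≡ true → H i j ≡ true
  covered i j o p with ∨-elim {Inside i j} p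
  ... | inj₁ q = A₀⊆H i j (proj₂ (proj₂ (∧₃-elim (V' i) (V' j) (A₀ i j) q)))
  ... | inj₂ q = incident⊆H i j o q
  3≤2n' : 3 ≤ 2 * n'
  3≤2n' = ≤-trans (m≤m+n 3 1) (*-monoʳ-≤ 2 2≤n')
  lower : 2 * size {n} full ≤ e + 3
  lower = begin
    2 * size {n} full              ≡⟨ cong (2 *_) (size-split V') ⟩
    2 * (n' + n'')                 ≡⟨ *-distribˡ-+ 2 n' n'' ⟩
    2 * n' + 2 * n''               ≡⟨ cong (_+ 2 * n'') (≡-sym (m∸n+n≡m 3≤2n')) ⟩
    (2 * n' ∸ 3) + 3 + 2 * n''     ≡⟨ solve 3 (λ x y z → x :+ y :+ z := x :+ z :+ y) refl (2 * n' ∸ 3) 3 (2 * n'') ⟩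
    (2 * n' ∸ 3) + 2 * n'' + 3     ≤⟨ +-monoˡ-≤ 3 (+-mono-≤ (≤-reflexive (≡-sym countA₀)) incident) ⟩
    countPairs Inside + countPairs Incident + 3
                                   ≤⟨ +-monoˡ-≤ 3 (countPairs-disjoint Inside Incident disjoint) ⟩
    countPairs (λ i j → Inside i j ∨ Incident i j) + 3
                                   ≤⟨ +-monoˡ-≤ 3 (countPairs-mono covered) ⟩
    e + 3                          ∎
    where open ≤-Reasoning

mainTheorem5 : ∀ {n} (G : Graph n) (C : VSet n) → Is3Core G C →
    (∀ v → In32 G C v) →
    (V' : VSet n) → RigidComponent G V' → 4 ≤ size V' →
    2 * size (compl V') ≤ incidentEdges G (compl V') →
    LamanSpanning G ⊎
    Σ (VSet n) (λ W → RigidComponent G W × 4 ≤ size W × ¬ SameSet W V')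
mainTheorem5 {n} G _ _ _ V' ((H₀ , sparse₀ , count₀) , _) 4≤n' incident
  with Greedy.greedy G V' (edge H₀) (cartesianProduct (allFin n) (allFin n)) (edge H₀)
         (esym H₀ , inG H₀ , sparse-on-full (edge H₀) V' (esym H₀) (inW H₀) sparse₀ , λ _ _ p → p)
... | inj₂ (S , rigidS , 4≤S , v , Sv , V'v) = inj₂ (secondComponent G V' S rigidS 4≤S v Sv V'v)
... | inj₁ (H , (symH , H⊆G , sparseH , H₀⊆H) , _ , added) =
  inj₁ (augmented⇒spanning G V' (edge H₀) H count₀ (≤-trans (s≤s (s≤s z≤n)) 4≤n') incident
          symH H⊆G sparseH H₀⊆H
          (λ i j i<j inc → added (i , j) (∈-cartesianProduct⁺ (∈-allFin i) (∈-allFin j)) (∧-intro i<j inc)))
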